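{- Consider $K$ hash tables, each with $2^t$ buckets addressed by $\{0,1\}^t$. Applying the Aggregate-Counts procedure to each table computes, for every table and every address $i$, the values $C_i[r]$ for $r=0,1,\dots,t$. Each $C_i[r]$ equals the total number of elements stored in that table in buckets at Hamming distance exactly $r$ from $i$. The total running time is $O(Kt^22^t)$ arithmetic operations.
   Context: For a single table, let $b_i$ be the number of elements in bucket $i\in\{0,1\}^t$, and let $\mathcal{N}_i$ be the set of the $t$ addresses at Hamming distance $1$ from $i$. Aggregate-Counts runs rounds $r=0,1,\dots,t$. In each round, for every address $i$ it sets: - $C_i[0]=b_i$ if $r=0$; - $C_i[1]=\sum_{j\in\mathcal{N}_i}C_j[0]$ if $r=1$; - $C_i[r]=\dfrac{\sum_{j\in\mathcal{N}_i}C_j[r-1]-(t-r+2)\,C_i[r-2]}{r}$ if $r\ge2$. It then returns all $C_i$. -}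

module Defs where

open import Data.Nat using (ℕ; zero; suc; _+_; _*_; _∸_; _≟_)
open import Data.Nat.DivMod using (_/_)
open import Data.Bool using (Bool; true; false; not; _xor_; if_then_else_)
open import Data.Fin using (Fin)
open import Data.Vec as V using (Vec; []; _∷_; lookup; updateAt)
open import Data.List as L using (List; []; _∷_; map; filter; _++_; allFin)
open import Data.Nat.ListAction using (sum)
open import Data.Product using (_×_; _,_; proj₁; proj₂)

Addr : ℕ → Set
Addr t = Vec Bool t

-- A single hash table: b i = number of elements stored in bucket i.
Table : ℕ → Set
Table t = Addr t → ℕ

allAddrs : (t : ℕ) → List (Addr t)
allAddrs zero    = [] ∷ []
allAddrs (suc t) = map (false ∷_) (allAddrs t) ++ map (true ∷_) (allAddrs t)

hamming : ∀ {t} → Addr t → Addr t → ℕ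
hamming []       []       = 0
hamming (x ∷ xs) (y ∷ ys) = (if x xor y then 1 else 0) + hamming xs ys

sphereCount : (t : ℕ) → Table t → Addr t → ℕ → ℕ
sphereCount t b i r = sum (map b (filter (λ j → hamming i j ≟ r) (allAddrs t)))

nbrs : ∀ {t} → Addr t → List (Addr t)
nbrs {t} i = map (λ (p : Fin t) → updateAt i p not) (allFin t)

-- Cost model: a computation returns its value together with the number
-- of arithmetic operations performed.

M : Set → Set
M A = A × ℕ

addM : ℕ → ℕ → M ℕ
addM x y = x + y , 1

sumM : List ℕ → M ℕ
sumM []       = 0 , 0
sumM (x ∷ xs) with sumM xs
... | s , c = x + s , suc c

-- one entry C_i[r] of round r, given rounds r-1 (prev1) and r-2 (prev2)
entry : (t : ℕ) → Table t → (r : ℕ) → (prev1 prev2 : Addr t → ℕ) → Addr t → M ℕ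
entry t b zero          prev1 prev2 i = b i , 0
entry t b (suc zero)    prev1 prev2 i = sumM (map prev1 (nbrs i))
entry t b (suc (suc k)) prev1 prev2 i with sumM (map prev1 (nbrs i))
... | s , c =
  -- computing (t - r + 2): 2 ops; multiplication: 1; subtraction: 1; division: 1
  let r = suc (suc k)
      m = (t ∸ r) + 2
  in (s ∸ (m * prev2 i)) / r , c + 5

-- layers b r = (C_·[r] , C_·[r-1])  (C_·[-1] taken as 0, never used)
layers : (t : ℕ) → Table t → ℕ → (Addr t → ℕ) × (Addr t → ℕ)
layers t b zero    = (λ i → proj₁ (entry t b zero (λ _ → 0) (λ _ → 0) i)) , (λ _ → 0)
layers t b (suc r) with layers t b r
... | cur , prev = (λ i → proj₁ (entry t b (suc r) cur prev i)) , cur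

aggregateCounts : (t : ℕ) → Table t → Addr t → ℕ → ℕ
aggregateCounts t b i r = proj₁ (layers t b r) i

roundCost : (t : ℕ) → Table t → ℕ → ℕ
roundCost t b zero    = sum (map (λ i → proj₂ (entry t b zero (λ _ → 0) (λ _ → 0) i)) (allAddrs t))
roundCost t b (suc r) with layers t b r
... | cur , prev = sum (map (λ i → proj₂ (entry t b (suc r) cur prev i)) (allAddrs t))

tableCost : (t : ℕ) → Table t → ℕ
tableCost t b = sum (map (roundCost t b) (L.upTo (suc t)))

totalCost : ∀ {K} (t : ℕ) → Vec (Table t) K → ℕ
totalCost t []       = 0
totalCost t (b ∷ bs) = tableCost t b + totalCost t bs

-- Fix i and a bucket j at distance d from i.  Among the t neighbours of i, exactly d
-- are at distance d - 1 from j and t - d at distance d + 1.  Summing the sphere counts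
-- S_i[r] of the neighbours therefore gives (r + 1) S_i[r + 1] + (t - r + 1) S_i[r - 1],
-- which is the recurrence Aggregate-Counts solves for S_i[r + 1]; so by two-step
-- induction C_i[r] = S_i[r].  Each round costs at most t + 5 operations per address,
-- hence (t + 1) 2^t (t + 5) ≤ 12 t² 2^t per table.
module Submission where

open import Defs
open import Data.Nat using (ℕ; zero; suc; _+_; _*_; _∸_; _^_; _≤_; z≤n; s≤s; _≟_; _≡ᵇ_; NonZero)
open import Data.Nat.Properties
open import Data.Nat.DivMod using (_/_; m*n/n≡m)
open import Data.Nat.ListAction using (sum)
open import Data.Nat.ListAction.Properties using (sum-++)
open import Data.Nat.Solver using (module +-*-Solver)
open import Data.Bool using (T; Bool; true; false; not; if_then_else_)
open import Data.Fin as F using (Fin; toℕ)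
open import Data.Fin.Properties using (toℕ≤pred[n])
open import Data.Vec using (Vec; []; _∷_; lookup; updateAt)
open import Data.List as L using (List; []; _∷_; map; filter; _++_; allFin; length)
open import Data.List.Properties using (map-tabulate; map-++; length-map; length-++; length-tabulate; length-upTo)
open import Data.Product using (_×_; _,_; proj₁; proj₂; ∃)
open import Function using (id; _∘_)
open import Relation.Nullary using (does)
open import Data.Unit using (tt)
open import Relation.Unary using (Decidable)
open import Relation.Binary.PropositionalEquality
  using (_≡_; refl; sym; trans; cong; cong₂; subst; subst₂; module ≡-Reasoning)

open +-*-Solver using (solve; _:+_; _:*_; _:=_; con)
open ≡-Reasoning

∑ : {A : Set} → List A → (A → ℕ) → ℕ
∑ xs f = sum (map f xs)

syntax ∑ xs (λ x → e) = ∑[ x ← xs ] e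

private variable A B : Set

∑-cong : (xs : List A) {f g : A → ℕ} → (∀ x → f x ≡ g x) → ∑ xs f ≡ ∑ xs g
∑-cong []       f≗g = refl
∑-cong (x ∷ xs) f≗g = cong₂ _+_ (f≗g x) (∑-cong xs f≗g)

∑-zero : (xs : List A) → ∑[ x ← xs ] 0 ≡ 0
∑-zero []       = refl
∑-zero (x ∷ xs) = ∑-zero xs

∑-distrib-+ : (xs : List A) (f g : A → ℕ) → ∑[ x ← xs ] (f x + g x) ≡ ∑ xs f + ∑ xs g
∑-distrib-+ []       f g = refl
∑-distrib-+ (x ∷ xs) f g rewrite ∑-distrib-+ xs f g = +-+-comm (f x) (g x) (∑ xs f) (∑ xs g)
  where +-+-comm = solve 4 (λ a b c d → (a :+ b) :+ (c :+ d) := (a :+ c) :+ (b :+ d)) refl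

*-distribˡ-∑ : (c : ℕ) (xs : List A) (f : A → ℕ) → c * ∑ xs f ≡ ∑[ x ← xs ] (c * f x)
*-distribˡ-∑ c []       f = *-zeroʳ c
*-distribˡ-∑ c (x ∷ xs) f rewrite sym (*-distribˡ-∑ c xs f) = *-distribˡ-+ c (f x) (∑ xs f)

*-distribʳ-∑ : (c : ℕ) (xs : List A) (f : A → ℕ) → ∑ xs f * c ≡ ∑[ x ← xs ] (f x * c)
*-distribʳ-∑ c []       f = refl
*-distribʳ-∑ c (x ∷ xs) f rewrite sym (*-distribʳ-∑ c xs f) = *-distribʳ-+ c (f x) (∑ xs f)

∑-++ : (xs ys : List A) (f : A → ℕ) → ∑ (xs ++ ys) f ≡ ∑ xs f + ∑ ys f
∑-++ xs ys f rewrite map-++ f xs ys = sum-++ (map f xs) (map f ys)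

∑-map : (h : A → B) (xs : List A) (f : B → ℕ) → ∑ (map h xs) f ≡ ∑[ x ← xs ] f (h x)
∑-map h []       f = refl
∑-map h (x ∷ xs) f = cong (f (h x) +_) (∑-map h xs f)

∑-comm : (xs : List A) (ys : List B) (f : A → B → ℕ) →
         ∑[ x ← xs ] ∑[ y ← ys ] f x y ≡ ∑[ y ← ys ] ∑[ x ← xs ] f x y
∑-comm []       ys f = sym (∑-zero ys)
∑-comm (x ∷ xs) ys f = begin
  ∑ ys (f x) + ∑[ x′ ← xs ] ∑ ys (f x′)      ≡⟨ cong (∑ ys (f x) +_) (∑-comm xs ys f) ⟩
  ∑ ys (f x) + ∑[ y ← ys ] ∑[ x′ ← xs ] f x′ y ≡⟨ sym (∑-distrib-+ ys (f x) _) ⟩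
  ∑[ y ← ys ] (f x y + ∑[ x′ ← xs ] f x′ y)  ∎

∑-≤-length* : (xs : List A) (f : A → ℕ) (c : ℕ) → (∀ x → f x ≤ c) → ∑ xs f ≤ length xs * c
∑-≤-length* []       f c f≤c = z≤n
∑-≤-length* (x ∷ xs) f c f≤c = +-mono-≤ (f≤c x) (∑-≤-length* xs f c f≤c)

∑-allFin-suc : (n : ℕ) (f : Fin (suc n) → ℕ) →
               ∑ (allFin (suc n)) f ≡ f F.zero + ∑[ p ← allFin n ] f (F.suc p)
∑-allFin-suc n f = cong (λ xs → f F.zero + sum xs)
  (trans (map-tabulate F.suc f) (sym (map-tabulate id (f ∘ F.suc))))

∑-allAddrs-suc : (t : ℕ) (f : Addr (suc t) → ℕ) →
                 ∑ (allAddrs (suc t)) f ≡ ∑[ j ← allAddrs t ] f (false ∷ j) + ∑[ j ← allAddrs t ] f (true ∷ j)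
∑-allAddrs-suc t f = trans (∑-++ (map (false ∷_) (allAddrs t)) _ f)
  (cong₂ _+_ (∑-map (false ∷_) (allAddrs t) f) (∑-map (true ∷_) (allAddrs t) f))

length-allAddrs : (t : ℕ) → length (allAddrs t) ≡ 2 ^ t
length-allAddrs zero    = refl
length-allAddrs (suc t) = begin
  length (map (false ∷_) (allAddrs t) ++ map (true ∷_) (allAddrs t))
    ≡⟨ length-++ (map (false ∷_) (allAddrs t)) ⟩
  length (map (false ∷_) (allAddrs t)) + length (map (true ∷_) (allAddrs t))
    ≡⟨ cong₂ _+_ (length-map (false ∷_) (allAddrs t)) (length-map (true ∷_) (allAddrs t)) ⟩
  length (allAddrs t) + length (allAddrs t)
    ≡⟨ cong (λ n → n + n) (length-allAddrs t) ⟩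
  2 ^ t + 2 ^ t
    ≡⟨ cong (2 ^ t +_) (sym (+-identityʳ (2 ^ t))) ⟩
  2 ^ t + (2 ^ t + 0) ∎

χ : Bool → ℕ
χ b = if b then 1 else 0

δ : ℕ → ℕ → ℕ
δ m n = χ (does (m ≟ n))

δ-subst : ∀ m n (f : ℕ → ℕ) → δ m n * f m ≡ δ m n * f n
-- `does (m ≟ n)` computes to `m ≡ᵇ n`, so that is what has to be analysed.
δ-subst m n f with m ≡ᵇ n in m≡ᵇn
... | false = refl
... | true rewrite ≡ᵇ⇒≡ m n (subst T (sym m≡ᵇn) tt) = refl

sum-filter : {P : A → Set} (P? : Decidable P) (b : A → ℕ) (xs : List A) →
             sum (map b (filter P? xs)) ≡ ∑[ x ← xs ] (χ (does (P? x)) * b x)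
sum-filter P? b []       = refl
sum-filter P? b (x ∷ xs) with does (P? x)
... | false = sum-filter P? b xs
... | true  = cong₂ _+_ (sym (+-identityʳ (b x))) (sum-filter P? b xs)

flipAt : ∀ {t} → Addr t → Fin t → Addr t
flipAt i p = updateAt i p not

hamming≤ : ∀ {t} (i j : Addr t) → hamming i j ≤ t
hamming≤ []          []          = z≤n
hamming≤ (false ∷ i) (false ∷ j) = m≤n⇒m≤1+n (hamming≤ i j)
hamming≤ (true  ∷ i) (true  ∷ j) = m≤n⇒m≤1+n (hamming≤ i j)
hamming≤ (false ∷ i) (true  ∷ j) = s≤s (hamming≤ i j)
hamming≤ (true  ∷ i) (false ∷ j) = s≤s (hamming≤ i j)

neighbourCount : ∀ {t} → Addr t → Addr t → ℕ → ℕ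
neighbourCount {t} i j r = ∑[ p ← allFin t ] δ (hamming (flipAt i p) j) r

neighbourCount-∷ : ∀ {t} x (i : Addr t) j r → neighbourCount (x ∷ i) j r
  ≡ δ (hamming (not x ∷ i) j) r + ∑[ p ← allFin t ] δ (hamming (x ∷ flipAt i p) j) r
neighbourCount-∷ {t} x i j r = ∑-allFin-suc t (λ p → δ (hamming (flipAt (x ∷ i) p) j) r)

-- Flipping the head bit of i moves it one step away from j if the head bits agree and one
-- step closer if they differ; every other flip acts on the tails.
neighbourCount≡ : ∀ {t} (i j : Addr t) r →
  neighbourCount i j r ≡ δ (hamming i j) (suc r) * suc r + δ (suc (hamming i j)) r * (t ∸ hamming i j)

neighbourCount-agree : ∀ {t} (i j : Addr t) r →
  δ (suc (hamming i j)) r + neighbourCount i j r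
    ≡ δ (hamming i j) (suc r) * suc r + δ (suc (hamming i j)) r * (suc t ∸ hamming i j)
neighbourCount-agree {t} i j r rewrite neighbourCount≡ i j r | +-∸-assoc 1 (hamming≤ i j) =
  regroup (δ (suc (hamming i j)) r) (δ (hamming i j) (suc r) * suc r) (t ∸ hamming i j)
  where
  regroup : ∀ a b c → a + (b + a * c) ≡ b + a * suc c
  regroup a b c rewrite *-suc a c = solve 3 (λ a b c → a :+ (b :+ a :* c) := b :+ (a :+ a :* c)) refl a b c

neighbourCount-differ : ∀ {t} (i j : Addr t) r →
  δ (hamming i j) r + ∑[ p ← allFin t ] δ (suc (hamming (flipAt i p) j)) r
    ≡ δ (hamming i j) r * suc r + δ (suc (suc (hamming i j))) r * (t ∸ hamming i j)
neighbourCount-differ {t} i j zero rewrite ∑-zero (allFin t) =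
  trans (+-identityʳ _) (sym (trans (+-identityʳ _) (*-identityʳ _)))
neighbourCount-differ i j (suc r) rewrite neighbourCount≡ i j r =
  regroup (δ (hamming i j) (suc r)) (suc r) (δ (suc (hamming i j)) r * (_ ∸ hamming i j))
  where
  regroup : ∀ a m b → a + (a * m + b) ≡ a * suc m + b
  regroup a m b rewrite *-suc a m = sym (+-assoc a (a * m) b)

neighbourCount≡ []          []          r rewrite *-zeroʳ (δ 1 r) = refl
neighbourCount≡ (false ∷ i) (false ∷ j) r = trans (neighbourCount-∷ _ i _ r) (neighbourCount-agree i j r)
neighbourCount≡ (true  ∷ i) (true  ∷ j) r = trans (neighbourCount-∷ _ i _ r) (neighbourCount-agree i j r)
neighbourCount≡ (false ∷ i) (true  ∷ j) r = trans (neighbourCount-∷ _ i _ r) (neighbourCount-differ i j r)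
neighbourCount≡ (true  ∷ i) (false ∷ j) r = trans (neighbourCount-∷ _ i _ r) (neighbourCount-differ i j r)

sphereSum : ∀ {t} → Table t → Addr t → ℕ → ℕ
sphereSum {t} b i r = ∑[ j ← allAddrs t ] (δ (hamming i j) r * b j)

sphereCount≡sphereSum : ∀ t (b : Table t) i r → sphereCount t b i r ≡ sphereSum b i r
sphereCount≡sphereSum t b i r = sum-filter (λ j → hamming i j ≟ r) b (allAddrs t)

sphereSum-zero : ∀ {t} (b : Table t) i → sphereSum b i 0 ≡ b i
sphereSum-zero {zero}  b []          = trans (+-identityʳ _) (+-identityʳ _)
sphereSum-zero {suc t} b (false ∷ i) = begin
  sphereSum b (false ∷ i) 0                            ≡⟨ ∑-allAddrs-suc t _ ⟩
  sphereSum (b ∘ (false ∷_)) i 0 + ∑[ j ← allAddrs t ] 0 ≡⟨ cong₂ _+_ (sphereSum-zero (b ∘ (false ∷_)) i) (∑-zero (allAddrs t)) ⟩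
  b (false ∷ i) + 0                                    ≡⟨ +-identityʳ _ ⟩
  b (false ∷ i)                                        ∎
sphereSum-zero {suc t} b (true ∷ i) = begin
  sphereSum b (true ∷ i) 0                            ≡⟨ ∑-allAddrs-suc t _ ⟩
  ∑[ j ← allAddrs t ] 0 + sphereSum (b ∘ (true ∷_)) i 0 ≡⟨ cong₂ _+_ (∑-zero (allAddrs t)) (sphereSum-zero (b ∘ (true ∷_)) i) ⟩
  b (true ∷ i)                                        ∎

∑-neighbours-sphereSum : ∀ {t} (b : Table t) i r →
  ∑[ p ← allFin t ] sphereSum b (flipAt i p) r ≡ ∑[ j ← allAddrs t ] (neighbourCount i j r * b j)
∑-neighbours-sphereSum {t} b i r = begin
  ∑[ p ← allFin t ] ∑[ j ← allAddrs t ] (δ (hamming (flipAt i p) j) r * b j)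
    ≡⟨ ∑-comm (allFin t) (allAddrs t) _ ⟩
  ∑[ j ← allAddrs t ] ∑[ p ← allFin t ] (δ (hamming (flipAt i p) j) r * b j)
    ≡⟨ ∑-cong (allAddrs t) (λ j → sym (*-distribʳ-∑ (b j) (allFin t) _)) ⟩
  ∑[ j ← allAddrs t ] (neighbourCount i j r * b j) ∎

sphereSum-neighbours-zero : ∀ {t} (b : Table t) i → ∑[ p ← allFin t ] sphereSum b (flipAt i p) 0 ≡ sphereSum b i 1
sphereSum-neighbours-zero {t} b i = trans (∑-neighbours-sphereSum b i 0) (∑-cong (allAddrs t) count)
  where
  count : ∀ j → neighbourCount i j 0 * b j ≡ δ (hamming i j) 1 * b j
  count j rewrite neighbourCount≡ i j 0 | +-identityʳ (δ (hamming i j) 1 * 1) | *-identityʳ (δ (hamming i j) 1) = refl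

sphereSum-neighbours-suc : ∀ {t} (b : Table t) i k → ∑[ p ← allFin t ] sphereSum b (flipAt i p) (suc k)
  ≡ suc (suc k) * sphereSum b i (suc (suc k)) + (t ∸ k) * sphereSum b i k
sphereSum-neighbours-suc {t} b i k = begin
  ∑[ p ← allFin t ] sphereSum b (flipAt i p) (suc k)
    ≡⟨ ∑-neighbours-sphereSum b i (suc k) ⟩
  ∑[ j ← allAddrs t ] (neighbourCount i j (suc k) * b j)
    ≡⟨ ∑-cong (allAddrs t) count ⟩
  ∑[ j ← allAddrs t ] (suc (suc k) * (δ (hamming i j) (suc (suc k)) * b j) + (t ∸ k) * (δ (hamming i j) k * b j))
    ≡⟨ ∑-distrib-+ (allAddrs t) _ _ ⟩
  ∑[ j ← allAddrs t ] (suc (suc k) * (δ (hamming i j) (suc (suc k)) * b j)) + ∑[ j ← allAddrs t ] ((t ∸ k) * (δ (hamming i j) k * b j))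
    ≡⟨ sym (cong₂ _+_ (*-distribˡ-∑ (suc (suc k)) (allAddrs t) _) (*-distribˡ-∑ (t ∸ k) (allAddrs t) _)) ⟩
  suc (suc k) * sphereSum b i (suc (suc k)) + (t ∸ k) * sphereSum b i k ∎
  where
  count : ∀ j → neighbourCount i j (suc k) * b j
                ≡ suc (suc k) * (δ (hamming i j) (suc (suc k)) * b j) + (t ∸ k) * (δ (hamming i j) k * b j)
  count j rewrite neighbourCount≡ i j (suc k) | δ-subst (hamming i j) k (t ∸_) =
    solve 5 (λ a m c z x → (a :* m :+ c :* z) :* x := m :* (a :* x) :+ z :* (c :* x)) refl
      (δ (hamming i j) (suc (suc k))) (suc (suc k)) (δ (hamming i j) k) (t ∸ k) (b j)

sumM≡sum,length : ∀ xs → sumM xs ≡ (sum xs , length xs)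
sumM≡sum,length []       = refl
sumM≡sum,length (x ∷ xs) rewrite sumM≡sum,length xs = refl

∑-nbrs : ∀ {t} (i : Addr t) (f : Addr t → ℕ) → sum (map f (nbrs i)) ≡ ∑[ p ← allFin t ] f (flipAt i p)
∑-nbrs {t} i f = ∑-map (flipAt i) (allFin t) f

entry-suc-suc : ∀ t (b : Table t) k prev1 prev2 i → entry t b (suc (suc k)) prev1 prev2 i
  ≡ ((sum (map prev1 (nbrs i)) ∸ (t ∸ suc (suc k) + 2) * prev2 i) / suc (suc k) , length (map prev1 (nbrs i)) + 5)
entry-suc-suc t b k prev1 prev2 i rewrite sumM≡sum,length (map prev1 (nbrs i)) = refl

aggregateCounts-one : ∀ t (b : Table t) i →
  aggregateCounts t b i 1 ≡ ∑[ p ← allFin t ] aggregateCounts t b (flipAt i p) 0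
aggregateCounts-one t b i = trans (cong proj₁ (sumM≡sum,length (map b (nbrs i)))) (∑-nbrs i b)

aggregateCounts-suc-suc : ∀ t (b : Table t) i k → aggregateCounts t b i (suc (suc k))
  ≡ (∑[ p ← allFin t ] aggregateCounts t b (flipAt i p) (suc k) ∸ (t ∸ suc (suc k) + 2) * aggregateCounts t b i k)
    / suc (suc k)
aggregateCounts-suc-suc t b i k =
  trans (cong proj₁ (entry-suc-suc t b k C[1+k] (λ j → aggregateCounts t b j k) i))
        (cong (λ s → (s ∸ (t ∸ suc (suc k) + 2) * aggregateCounts t b i k) / suc (suc k)) (∑-nbrs i C[1+k]))
  where
  C[1+k] : Addr t → ℕ
  C[1+k] j = aggregateCounts t b j (suc k)

m∸[2+n]+2≡m∸n : ∀ m n → 2 + n ≤ m → m ∸ (2 + n) + 2 ≡ m ∸ n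
m∸[2+n]+2≡m∸n (suc (suc m)) zero    _         = +-comm m 2
m∸[2+n]+2≡m∸n (suc m)       (suc n) (s≤s le) = m∸[2+n]+2≡m∸n m n le

[n*x+z∸z]/n≡x : ∀ n x z .{{_ : NonZero n}} → (n * x + z ∸ z) / n ≡ x
[n*x+z∸z]/n≡x n x z rewrite m+n∸n≡m (n * x) z | *-comm n x = m*n/n≡m x n

-- r ≤ t is needed because the algorithm computes t − r + 2 with truncated subtraction.
aggregateCounts≡sphereSum : ∀ t (b : Table t) r → r ≤ t → ∀ i → aggregateCounts t b i r ≡ sphereSum b i r
aggregateCounts≡sphereSum t b zero          _  i = sym (sphereSum-zero b i)
aggregateCounts≡sphereSum t b (suc zero)    _  i = begin
  aggregateCounts t b i 1                            ≡⟨ aggregateCounts-one t b i ⟩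
  ∑[ p ← allFin t ] aggregateCounts t b (flipAt i p) 0 ≡⟨ ∑-cong (allFin t) (λ p → sym (sphereSum-zero b (flipAt i p))) ⟩
  ∑[ p ← allFin t ] sphereSum b (flipAt i p) 0        ≡⟨ sphereSum-neighbours-zero b i ⟩
  sphereSum b i 1                                    ∎
aggregateCounts≡sphereSum t b (suc (suc k)) le i = begin
  aggregateCounts t b i (2 + k)
    ≡⟨ aggregateCounts-suc-suc t b i k ⟩
  (∑[ p ← allFin t ] aggregateCounts t b (flipAt i p) (1 + k) ∸ (t ∸ (2 + k) + 2) * aggregateCounts t b i k) / (2 + k)
    ≡⟨ cong₂ (λ s c → (s ∸ (t ∸ (2 + k) + 2) * c) / (2 + k))
         (∑-cong (allFin t) (λ p → aggregateCounts≡sphereSum t b (suc k) (m+n≤o⇒n≤o 1 le) (flipAt i p)))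
         (aggregateCounts≡sphereSum t b k (m+n≤o⇒n≤o 2 le) i) ⟩
  (∑[ p ← allFin t ] sphereSum b (flipAt i p) (1 + k) ∸ (t ∸ (2 + k) + 2) * sphereSum b i k) / (2 + k)
    ≡⟨ cong (λ m → (∑[ p ← allFin t ] sphereSum b (flipAt i p) (1 + k) ∸ m * sphereSum b i k) / (2 + k))
         (m∸[2+n]+2≡m∸n t k le) ⟩
  (∑[ p ← allFin t ] sphereSum b (flipAt i p) (1 + k) ∸ (t ∸ k) * sphereSum b i k) / (2 + k)
    ≡⟨ cong (λ s → (s ∸ (t ∸ k) * sphereSum b i k) / (2 + k)) (sphereSum-neighbours-suc b i k) ⟩
  ((2 + k) * sphereSum b i (2 + k) + (t ∸ k) * sphereSum b i k ∸ (t ∸ k) * sphereSum b i k) / (2 + k)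
    ≡⟨ [n*x+z∸z]/n≡x (2 + k) (sphereSum b i (2 + k)) ((t ∸ k) * sphereSum b i k) ⟩
  sphereSum b i (2 + k) ∎

aggregateCounts≡sphereCount : ∀ t (b : Table t) r → r ≤ t → ∀ i → aggregateCounts t b i r ≡ sphereCount t b i r
aggregateCounts≡sphereCount t b r r≤t i =
  trans (aggregateCounts≡sphereSum t b r r≤t i) (sym (sphereCount≡sphereSum t b i r))

length-nbrs : ∀ {t} (i : Addr t) → length (nbrs i) ≡ t
length-nbrs {t} i = trans (length-map (flipAt i) (allFin t)) (length-tabulate id)

entry-cost : ∀ t (b : Table t) r prev1 prev2 i → proj₂ (entry t b r prev1 prev2 i) ≤ t + 5
entry-cost t b zero          prev1 prev2 i = z≤n
entry-cost t b (suc zero)    prev1 prev2 i rewrite sumM≡sum,length (map prev1 (nbrs i))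
                                                  | length-map prev1 (nbrs i) | length-nbrs i = m≤m+n t 5
entry-cost t b (suc (suc k)) prev1 prev2 i = ≤-reflexive (begin
  proj₂ (entry t b (suc (suc k)) prev1 prev2 i) ≡⟨ cong proj₂ (entry-suc-suc t b k prev1 prev2 i) ⟩
  length (map prev1 (nbrs i)) + 5             ≡⟨ cong (_+ 5) (trans (length-map prev1 (nbrs i)) (length-nbrs i)) ⟩
  t + 5                                       ∎)

roundCost≤ : ∀ t (b : Table t) r → roundCost t b r ≤ 2 ^ t * (t + 5)
roundCost≤ t b zero rewrite sym (length-allAddrs t) =
  ∑-≤-length* (allAddrs t) _ (t + 5) (λ i → z≤n)
roundCost≤ t b (suc r) with layers t b r
... | cur , prev rewrite sym (length-allAddrs t) =
  ∑-≤-length* (allAddrs t) _ (t + 5) (entry-cost t b (suc r) cur prev)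

tableCost≤ : ∀ t (b : Table t) → tableCost t b ≤ suc t * (2 ^ t * (t + 5))
tableCost≤ t b = subst (λ n → tableCost t b ≤ n * (2 ^ t * (t + 5))) (length-upTo (suc t))
  (∑-≤-length* (L.upTo (suc t)) (roundCost t b) _ (roundCost≤ t b))

totalCost≤ : ∀ {K} t (T : Vec (Table t) K) → totalCost t T ≤ K * (suc t * (2 ^ t * (t + 5)))
totalCost≤ t []      = z≤n
totalCost≤ t (b ∷ T) = +-mono-≤ (tableCost≤ t b) (totalCost≤ t T)

costBound≤12Kt²2ᵗ : ∀ K t → 1 ≤ t → K * (suc t * (2 ^ t * (t + 5))) ≤ 12 * K * t ^ 2 * 2 ^ t
costBound≤12Kt²2ᵗ K t 1≤t = subst₂ _≤_ lhs rhs (*-monoʳ-≤ (K * 2 ^ t) (*-mono-≤ 1+t≤t+t t+5≤t+5t))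
  where
  1+t≤t+t : suc t ≤ t + t
  1+t≤t+t = +-monoˡ-≤ t 1≤t
  t+5≤t+5t : t + 5 ≤ t + 5 * t
  t+5≤t+5t = +-monoʳ-≤ t (*-monoʳ-≤ 5 1≤t)
  lhs : K * 2 ^ t * (suc t * (t + 5)) ≡ K * (suc t * (2 ^ t * (t + 5)))
  lhs = solve 3 (λ K P t → K :* P :* ((con 1 :+ t) :* (t :+ con 5)) := K :* ((con 1 :+ t) :* (P :* (t :+ con 5))))
          refl K (2 ^ t) t
  rhs : K * 2 ^ t * ((t + t) * (t + 5 * t)) ≡ 12 * K * t ^ 2 * 2 ^ t
  rhs = solve 3 (λ K P t → K :* P :* ((t :+ t) :* (t :+ con 5 :* t)) := con 12 :* K :* (t :* (t :* con 1)) :* P)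
          refl K (2 ^ t) t

theorem3 : ((K t : ℕ) (T : Vec (Table t) K) (k : Fin K) (i : Addr t) (r : Fin (suc t)) →
               aggregateCounts t (lookup T k) i (toℕ r) ≡ sphereCount t (lookup T k) i (toℕ r))
             × ∃ (λ (c : ℕ) → (K t : ℕ) → 1 ≤ t → (T : Vec (Table t) K) →
               totalCost t T ≤ c * K * t ^ 2 * 2 ^ t)
theorem3 = (λ K t T k i r → aggregateCounts≡sphereCount t (lookup T k) (toℕ r) (toℕ≤pred[n] r) i)
         , (12 , λ K t 1≤t T → ≤-trans (totalCost≤ t T) (costBound≤12Kt²2ᵗ K t 1≤t))
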